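{- Let $B>1$ and $N>1$ be integers with $\gcd(N,B)=1$, let $e=\operatorname{ord}(B,N)$, and let $d_1,d_2$ be positive integers with $d_1\mid d_2$ and $d_2\mid e$. If $N\in M_{d_1}(B)$, then $N\in M_{d_2}(B)$.
   Context: $\operatorname{ord}(B,N)$ is the least positive integer $e$ with $B^e\equiv1\pmod N$. For a divisor $d$ of $e$ put $k=e/d$. For $x$ with $1\le x<N$, $\gcd(x,N)=1$, let $x/N=0.a_1a_2\ldots$ be its base-$B$ expansion (purely periodic with period $a_1\ldots a_e$), and let $S_d(x)=\sum_{j=1}^d\sum_{i=1}^k a_{(j-1)k+i}B^{k-i}$ be the sum of the integers represented in base $B$ by the $d$ consecutive blocks of length $k$ of the period. We say $N\in M_d(B)$ if $S_d(x)\equiv0\pmod{B^k-1}$ for every such $x$. -}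

module Defs where

open import Data.Nat using (ℕ; zero; suc; _+_; _*_; _∸_; _^_; _<_; _≤_; NonZero)
open import Data.Nat.DivMod using (_/_; _%_)
open import Data.Nat.Divisibility using (_∣_)
open import Data.Nat.Coprimality using (Coprime)
open import Relation.Binary.PropositionalEquality using (_≡_; _≢_)
open import Data.Product using (_×_)

sumTo : ℕ → (ℕ → ℕ) → ℕ
sumTo zero    f = 0
sumTo (suc n) f = sumTo n f + f n

IsOrd : (B N e : ℕ) → .{{_ : NonZero N}} → Set
IsOrd B N e =
  (0 < e) × ((B ^ e) % N ≡ 1 % N)
          × (∀ e′ → 0 < e′ → e′ < e → (B ^ e′) % N ≢ 1 % N)

-- i-th base-B digit (i ≥ 1) of x/N = 0.a₁a₂… : aᵢ = ⌊Bⁱ x / N⌋ mod B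
digit : (B N x i : ℕ) → .{{_ : NonZero B}} → .{{_ : NonZero N}} → ℕ
digit B N x i = ((B ^ i * x) / N) % B

-- S_d(x) = Σ_{j=1}^{d} Σ_{i=1}^{k} a_{(j-1)k+i} B^{k-i},   k = e / d
-- (written with shifted indices j' = j-1, i' = i-1 running from 0)
Sd : (B N e d x : ℕ) → .{{_ : NonZero B}} → .{{_ : NonZero N}} → .{{_ : NonZero d}} → ℕ
Sd B N e d x =
  sumTo d (λ j → sumTo k (λ i → digit B N x (j * k + i + 1) * B ^ (k ∸ (i + 1))))
  where k = e / d

InM : (B N e d : ℕ) → .{{_ : NonZero B}} → .{{_ : NonZero N}} → .{{_ : NonZero d}} → Set
InM B N e d = ∀ x → 1 ≤ x → x < N → Coprime x N → (B ^ (e / d) ∸ 1) ∣ Sd B N e d x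

{-# OPTIONS --safe #-}
module Submission where

-- Modulo n = B^k - 1 we have B^k ≡ 1, so the value of a block of m k digits is congruent
-- to the sum of its m sub-blocks of k digits.  Hence S_{d₁}, taken with blocks of length
-- e/d₁ = m k, is congruent to S_{d₂}, taken with blocks of length e/d₂ = k, where d₂ = m d₁;
-- and B^k - 1 divides B^{mk} - 1, which divides S_{d₁}.  This works for any digit sequence:
-- of the hypotheses on B, N and e, only B > 1 and e > 0 are needed.

open import Defs
open import Data.Nat using (ℕ; _<_; NonZero)
open import Data.Nat.Divisibility using (_∣_)
open import Data.Nat.Coprimality using (Coprime)
open import Data.Nat.Base using (zero; suc; _+_; _*_; _∸_; _^_; _≤_; >-nonZero; >-nonZero⁻¹)
open import Data.Nat.Properties
open import Data.Nat.DivMod using (_%_; _/_; %-distribˡ-+; %-distribˡ-*; [m+n]%n≡m%n; m*n/n≡m)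
open import Data.Nat.Divisibility
  using (divides; ∣-trans; ∣m∣n⇒∣m+n; m∣m*n; m%n≡0⇒n∣m; n∣m⇒m%n≡0)
open import Data.Product using (proj₁)
open import Function using (_∘_)
open import Relation.Binary.PropositionalEquality
  using (_≡_; refl; sym; trans; cong; cong₂; subst; subst₂; module ≡-Reasoning)

open ≡-Reasoning

sumTo-cong : ∀ n {f g : ℕ → ℕ} → (∀ {i} → i < n → f i ≡ g i) → sumTo n f ≡ sumTo n g
sumTo-cong zero    f≡g = refl
sumTo-cong (suc n) f≡g = cong₂ _+_ (sumTo-cong n (f≡g ∘ m<n⇒m<1+n)) (f≡g (n<1+n n))

sumTo-+ : ∀ m n (f : ℕ → ℕ) → sumTo (m + n) f ≡ sumTo m f + sumTo n (λ i → f (m + i))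
sumTo-+ m zero    f = trans (cong (λ l → sumTo l f) (+-identityʳ m)) (sym (+-identityʳ _))
sumTo-+ m (suc n) f = begin
  sumTo (m + suc n) f                                ≡⟨ cong (λ l → sumTo l f) (+-suc m n) ⟩
  sumTo (m + n) f + f (m + n)                        ≡⟨ cong (_+ f (m + n)) (sumTo-+ m n f) ⟩
  sumTo m f + sumTo n (λ i → f (m + i)) + f (m + n)  ≡⟨ +-assoc (sumTo m f) _ _ ⟩
  sumTo m f + sumTo (suc n) (λ i → f (m + i))        ∎

sumTo-* : ∀ m n (f : ℕ → ℕ) → sumTo (m * n) f ≡ sumTo m (λ j → sumTo n (λ i → f (j * n + i)))
sumTo-* zero    n f = refl
sumTo-* (suc m) n f = begin
  sumTo (n + m * n) f                              ≡⟨ cong (λ l → sumTo l f) (+-comm n (m * n)) ⟩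
  sumTo (m * n + n) f                              ≡⟨ sumTo-+ (m * n) n f ⟩
  sumTo (m * n) f + sumTo n (λ i → f (m * n + i))
    ≡⟨ cong (_+ sumTo n (λ i → f (m * n + i))) (sumTo-* m n f) ⟩
  sumTo (suc m) (λ j → sumTo n (λ i → f (j * n + i))) ∎

sumTo-distribʳ-* : ∀ n (f : ℕ → ℕ) c → sumTo n f * c ≡ sumTo n (λ i → f i * c)
sumTo-distribʳ-* zero    f c = refl
sumTo-distribʳ-* (suc n) f c = begin
  (sumTo n f + f n) * c      ≡⟨ *-distribʳ-+ c (sumTo n f) (f n) ⟩
  sumTo n f * c + f n * c    ≡⟨ cong (_+ f n * c) (sumTo-distribʳ-* n f c) ⟩
  sumTo (suc n) (λ i → f i * c) ∎

infix 4 _≡_[mod_]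
_≡_[mod_] : ℕ → ℕ → (n : ℕ) → .{{NonZero n}} → Set
a ≡ b [mod n ] = a % n ≡ b % n

module _ {n : ℕ} .{{_ : NonZero n}} where

  +-cong-mod : ∀ {a a′ b b′} → a ≡ a′ [mod n ] → b ≡ b′ [mod n ] → a + b ≡ a′ + b′ [mod n ]
  +-cong-mod {a} {a′} {b} {b′} a≡a′ b≡b′ = begin
    (a + b) % n              ≡⟨ %-distribˡ-+ a b n ⟩
    (a % n + b % n) % n      ≡⟨ cong₂ (λ x y → (x + y) % n) a≡a′ b≡b′ ⟩
    (a′ % n + b′ % n) % n    ≡⟨ sym (%-distribˡ-+ a′ b′ n) ⟩
    (a′ + b′) % n            ∎

  *-cong-mod : ∀ {a a′ b b′} → a ≡ a′ [mod n ] → b ≡ b′ [mod n ] → a * b ≡ a′ * b′ [mod n ]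
  *-cong-mod {a} {a′} {b} {b′} a≡a′ b≡b′ = begin
    (a * b) % n              ≡⟨ %-distribˡ-* a b n ⟩
    (a % n * (b % n)) % n    ≡⟨ cong₂ (λ x y → (x * y) % n) a≡a′ b≡b′ ⟩
    (a′ % n * (b′ % n)) % n  ≡⟨ sym (%-distribˡ-* a′ b′ n) ⟩
    (a′ * b′) % n            ∎

  sumTo-cong-mod : ∀ l {f g : ℕ → ℕ} → (∀ i → f i ≡ g i [mod n ]) → sumTo l f ≡ sumTo l g [mod n ]
  sumTo-cong-mod zero    f≡g = refl
  sumTo-cong-mod (suc l) f≡g = +-cong-mod (sumTo-cong-mod l f≡g) (f≡g l)

  ∣-resp-≡-mod : ∀ {a b} → a ≡ b [mod n ] → n ∣ a → n ∣ b
  ∣-resp-≡-mod {a} {b} a≡b n∣a = m%n≡0⇒n∣m b n (trans (sym a≡b) (n∣m⇒m%n≡0 a n n∣a))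

n∣[1+n]^m∸1 : ∀ n m → n ∣ (1 + n) ^ m ∸ 1
n∣[1+n]^m∸1 n zero    = divides 0 refl
n∣[1+n]^m∸1 n (suc m) = subst (n ∣_) (sym [1+n]^[1+m]∸1≡) (∣m∣n⇒∣m+n (n∣[1+n]^m∸1 n m) (m∣m*n _))
  where
  x : ℕ
  x = (1 + n) ^ m
  [1+n]^[1+m]∸1≡ : (1 + n) * x ∸ 1 ≡ (x ∸ 1) + n * x
  [1+n]^[1+m]∸1≡ = +-∸-comm (n * x) (m^n>0 (1 + n) m)

block : ℕ → (ℕ → ℕ) → ℕ → ℕ → ℕ
block B a k p = sumTo k (λ i → a (p + i + 1) * B ^ (k ∸ (i + 1)))

-- Sd B N e d x unfolds to blockSum B (digit B N x) d (e / d).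
blockSum : ℕ → (ℕ → ℕ) → ℕ → ℕ → ℕ
blockSum B a d k = sumTo d (λ j → block B a k (j * k))

block-+ : ∀ B a m n p → block B a (m + n) p ≡ block B a m p * B ^ n + block B a n (p + m)
block-+ B a m n p = begin
  block B a (m + n) p
    ≡⟨ sumTo-+ m n _ ⟩
  sumTo m (λ i → a (p + i + 1) * B ^ (m + n ∸ (i + 1)))
    + sumTo n (λ i → a (p + (m + i) + 1) * B ^ (m + n ∸ (m + i + 1)))
    ≡⟨ cong₂ _+_ (sumTo-cong m high) (sumTo-cong n (λ {i} _ → low i)) ⟩
  sumTo m (λ i → a (p + i + 1) * B ^ (m ∸ (i + 1)) * B ^ n) + block B a n (p + m)
    ≡⟨ cong (_+ block B a n (p + m)) (sym (sumTo-distribʳ-* m _ (B ^ n))) ⟩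
  block B a m p * B ^ n + block B a n (p + m) ∎
  where
  high : ∀ {i} → i < m →
         a (p + i + 1) * B ^ (m + n ∸ (i + 1)) ≡ a (p + i + 1) * B ^ (m ∸ (i + 1)) * B ^ n
  high {i} i<m = begin
    a (p + i + 1) * B ^ (m + n ∸ (i + 1))
      ≡⟨ cong (λ x → a (p + i + 1) * B ^ x) (+-∸-comm n i+1≤m) ⟩
    a (p + i + 1) * B ^ (m ∸ (i + 1) + n)
      ≡⟨ cong (a (p + i + 1) *_) (^-distribˡ-+-* B (m ∸ (i + 1)) n) ⟩
    a (p + i + 1) * (B ^ (m ∸ (i + 1)) * B ^ n)
      ≡⟨ sym (*-assoc (a (p + i + 1)) _ _) ⟩
    a (p + i + 1) * B ^ (m ∸ (i + 1)) * B ^ n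
      ∎
    where
    i+1≤m : i + 1 ≤ m
    i+1≤m = subst (_≤ m) (+-comm 1 i) i<m
  low : ∀ i →
        a (p + (m + i) + 1) * B ^ (m + n ∸ (m + i + 1)) ≡ a (p + m + i + 1) * B ^ (n ∸ (i + 1))
  low i = cong₂ (λ j x → a (j + 1) * B ^ x)
    (sym (+-assoc p m i))
    (trans (cong (m + n ∸_) (+-assoc m i 1)) ([m+n]∸[m+o]≡n∸o m n (i + 1)))

module _ {n : ℕ} .{{_ : NonZero n}} {B k : ℕ} (Bᵏ≡1 : B ^ k ≡ 1 [mod n ]) (a : ℕ → ℕ) where

  block-*-mod : ∀ m p → block B a (m * k) p ≡ sumTo m (λ t → block B a k (p + t * k)) [mod n ]
  block-*-mod zero    p = refl
  block-*-mod (suc m) p = begin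
    block B a (k + m * k) p % n          ≡⟨ cong (λ l → block B a l p % n) (+-comm k (m * k)) ⟩
    block B a (m * k + k) p % n          ≡⟨ cong (_% n) (block-+ B a (m * k) k p) ⟩
    (X * B ^ k + Y) % n
      ≡⟨ +-cong-mod {b = Y} {b′ = Y} (*-cong-mod {a = X} {a′ = X} refl Bᵏ≡1) refl ⟩
    (X * 1 + Y) % n                      ≡⟨ cong (λ x → (x + Y) % n) (*-identityʳ X) ⟩
    (X + Y) % n                          ≡⟨ +-cong-mod {b = Y} {b′ = Y} (block-*-mod m p) refl ⟩
    sumTo (suc m) (λ t → block B a k (p + t * k)) % n ∎
    where
    X Y : ℕ
    X = block B a (m * k) p
    Y = block B a k (p + m * k)

  blockSum-*-mod : ∀ d m → blockSum B a d (m * k) ≡ blockSum B a (d * m) k [mod n ]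
  blockSum-*-mod d m = begin
    blockSum B a d (m * k) % n
      ≡⟨ sumTo-cong-mod d (λ j → block-*-mod m (j * (m * k))) ⟩
    sumTo d (λ j → sumTo m (λ t → block B a k (j * (m * k) + t * k))) % n
      ≡⟨ cong (_% n) (sumTo-cong d λ {j} _ →
           sumTo-cong m λ {t} _ → cong (block B a k) (sym (index j t))) ⟩
    sumTo d (λ j → sumTo m (λ t → block B a k ((j * m + t) * k))) % n
      ≡⟨ cong (_% n) (sym (sumTo-* d m (λ s → block B a k (s * k)))) ⟩
    blockSum B a (d * m) k % n ∎
    where
    index : ∀ j t → (j * m + t) * k ≡ j * (m * k) + t * k
    index j t = trans (*-distribʳ-+ k (j * m) t) (cong (_+ t * k) (*-assoc j m k))

∣blockSum-refine : ∀ B a d m k → 1 < B ^ k →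
                   (B ^ (m * k) ∸ 1) ∣ blockSum B a d (m * k) → (B ^ k ∸ 1) ∣ blockSum B a (d * m) k
∣blockSum-refine B a d m k 1<Bᵏ ∣S₁ = ∣-resp-≡-mod (blockSum-*-mod Bᵏ≡1 a d m) (∣-trans n∣Bᵐᵏ∸1 ∣S₁)
  where
  n : ℕ
  n = B ^ k ∸ 1
  instance
    n≢0 : NonZero n
    n≢0 = >-nonZero (m<n⇒0<n∸m 1<Bᵏ)
  Bᵏ≡1+n : B ^ k ≡ 1 + n
  Bᵏ≡1+n = sym (m+[n∸m]≡n (<⇒≤ 1<Bᵏ))
  Bᵏ≡1 : B ^ k ≡ 1 [mod n ]
  Bᵏ≡1 = trans (cong (_% n) Bᵏ≡1+n) ([m+n]%n≡m%n 1 n)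
  n∣Bᵐᵏ∸1 : n ∣ B ^ (m * k) ∸ 1
  n∣Bᵐᵏ∸1 = subst (λ x → n ∣ x ∸ 1) [1+n]^m≡Bᵐᵏ (n∣[1+n]^m∸1 n m)
    where
    [1+n]^m≡Bᵐᵏ : (1 + n) ^ m ≡ B ^ (m * k)
    [1+n]^m≡Bᵐᵏ = begin
      (1 + n) ^ m   ≡⟨ cong (_^ m) (sym Bᵏ≡1+n) ⟩
      (B ^ k) ^ m   ≡⟨ ^-*-assoc B k m ⟩
      B ^ (k * m)   ≡⟨ cong (B ^_) (*-comm k m) ⟩
      B ^ (m * k)   ∎

theorem5 : (B N e d₁ d₂ : ℕ) → {{_ : NonZero B}} → {{_ : NonZero N}}
           → {{_ : NonZero d₁}} → {{_ : NonZero d₂}}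
           → 1 < B → 1 < N → Coprime N B → IsOrd B N e
           → d₁ ∣ d₂ → d₂ ∣ e
           → InM B N e d₁ → InM B N e d₂
theorem5 B N e d₁ d₂ 1<B _ _ ord (divides m refl) (divides k refl) M₁ x 1≤x x<N x⊥N =
  subst₂ (λ K d → (B ^ K ∸ 1) ∣ blockSum B a d K) (sym e/d₂≡k) (*-comm d₁ m)
    (∣blockSum-refine B a d₁ m k 1<Bᵏ
      (subst (λ K → (B ^ K ∸ 1) ∣ blockSum B a d₁ K) e/d₁≡mk (M₁ x 1≤x x<N x⊥N)))
  where
  a : ℕ → ℕ
  a i = digit B N x i
  1<Bᵏ : 1 < B ^ k
  1<Bᵏ = ^-monoʳ-< B 1<B (>-nonZero⁻¹ k {{m*n≢0⇒m≢0 k {{>-nonZero (proj₁ ord)}}}})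
  e/d₂≡k : k * (m * d₁) / (m * d₁) ≡ k
  e/d₂≡k = m*n/n≡m k (m * d₁)
  e/d₁≡mk : k * (m * d₁) / d₁ ≡ m * k
  e/d₁≡mk = begin
    k * (m * d₁) / d₁  ≡⟨ cong (_/ d₁) (trans (sym (*-assoc k m d₁)) (cong (_* d₁) (*-comm k m))) ⟩
    m * k * d₁ / d₁    ≡⟨ m*n/n≡m (m * k) d₁ ⟩
    m * k              ∎
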